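{- Let $\mathcal{O}$ be an annotated $\mathcal{ELH}^r$ ontology, $C,C_1,C_2,D_1,D_2,D,D'$ $\mathcal{ELH}^r$ concepts, $S,R\in N_R$, and $m,m_1,m_2\in N_M$. (1) If $\mathcal{O}\models(C\sqsubseteq C_1\sqcap C_2,m)$, $\mathcal{O}\models(C_1\sqsubseteq D_1,m_1)$ and $\mathcal{O}\models(C_2\sqsubseteq D_2,m_2)$, then $\mathcal{O}\models(C\sqsubseteq D_1\sqcap D_2,m\times m_1\times m_2)$. (2) If $\mathcal{O}\models(C\sqsubseteq\exists S.D',m)$ and $\mathcal{O}\models(D'\sqsubseteq D,m_1)$, then $\mathcal{O}\models(C\sqsubseteq\exists S.D,m\times m_1)$. (3) If $\mathcal{O}\models(C\sqsubseteq\exists R.D,m)$ and $\mathcal{O}\models(R\sqsubseteq S,m_1)$, then $\mathcal{O}\models(C\sqsubseteq\exists S.D,m\times m_1)$.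
   Context: Fix pairwise disjoint countably infinite sets $N_C$, $N_R$, $N_I$, $N_V$ (concept, role, individual names, provenance variables). Monomials: finite products of variables (empty product $1$), $N_M$ their set, computed in the Trio semiring ($\times$ commutative, associative, idempotent), so $m\approx n$ iff they contain the same variables. $\mathcal{ELH}^r$ concepts $C::=A\mid\exists R.C\mid C\sqcap C\mid\top$; axioms: GCIs $C\sqsubseteq D$ with $D::=A\mid\exists R$, role inclusions $R\sqsubseteq S$, range restrictions ${\sf ran}(R)\sqsubseteq A$, assertions $A(a)$, $R(a,b)$. Annotated ontology: finite set of $(\alpha,v)$, $v\in N_V\cup\{1\}$. Annotated interpretation $\mathcal{I}$: domain $\Delta^\mathcal{I}$, disjoint monomial domain $\Delta^\mathcal{I}_m$, $a^\mathcal{I}\in\Delta^\mathcal{I}$, $A^\mathcal{I}\subseteq\Delta^\mathcal{I}\times\Delta^\mathcal{I}_m$, $R^\mathcal{I}\subseteq\Delta^\mathcal{I}\times\Delta^\mathcal{I}\times\Delta^\mathcal{I}_m$, $m^\mathcal{I}\in\Delta^\mathcal{I}_m$ with $m^\mathcal{I}=n^\mathcal{I}$ iff $m\approx n$; $\top^\mathcal{I}=\Delta^\mathcal{I}\times\{1^\mathcal{I}\}$, $(\exists R)^\mathcal{I}=\{(d,\mu)\mid\exists e\,(d,e,\mu)\in R^\mathcal{I}\}$, $({\sf ran}(R))^\mathcal{I}=\{(e,\mu)\mid\exists d\,(d,e,\mu)\in R^\mathcal{I}\}$, $(C\sqcap D)^\mathcal{I}=\{(d,(m\times n)^\mathcal{I})\mid(d,m^\mathcal{I})\in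 C^\mathcal{I},(d,n^\mathcal{I})\in D^\mathcal{I}\}$, $(\exists R.C)^\mathcal{I}=\{(d,(m\times n)^\mathcal{I})\mid\exists e\,(d,e,m^\mathcal{I})\in R^\mathcal{I},(e,n^\mathcal{I})\in C^\mathcal{I}\}$. $\mathcal{I}$ satisfies $(R\sqsubseteq S,m)$ iff $(d,e,n^\mathcal{I})\in R^\mathcal{I}\Rightarrow(d,e,(m\times n)^\mathcal{I})\in S^\mathcal{I}$ for all $n\in N_M$; for arbitrary concepts $C,D$ (or $C={\sf ran}(R)$), $\mathcal{I}$ satisfies $(C\sqsubseteq D,m)$ iff $(d,n^\mathcal{I})\in C^\mathcal{I}\Rightarrow(d,(m\times n)^\mathcal{I})\in D^\mathcal{I}$ for all $n$; it satisfies $(A(a),m)$ iff $(a^\mathcal{I},m^\mathcal{I})\in A^\mathcal{I}$ and $(R(a,b),m)$ iff $(a^\mathcal{I},b^\mathcal{I},m^\mathcal{I})\in R^\mathcal{I}$. $\mathcal{O}\models(\beta,m)$ iff every model of $\mathcal{O}$ satisfies $(\beta,m)$. -}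

module Defs where

open import Data.Nat using (ℕ)
open import Data.List using (List; []; _∷_; _++_)
open import Data.List.Membership.Propositional using (_∈_)
open import Data.Maybe using (Maybe; just; nothing)
open import Data.Product using (Σ; ∃; _×_; _,_)
open import Relation.Binary.PropositionalEquality using (_≡_)
open import Function.Bundles using (_⇔_)

ConceptName : Set
ConceptName = ℕ

RoleName : Set
RoleName = ℕ

IndName : Set
IndName = ℕ

Var : Set
Var = ℕ

Monomial : Set
Monomial = List Var

𝟙 : Monomial
𝟙 = []

infixl 7 _×ₘ_
_×ₘ_ : Monomial → Monomial → Monomial
m ×ₘ n = m ++ n

-- Trio-semiring equivalence: same set of variables.
_≈ₘ_ : Monomial → Monomial → Set
m ≈ₘ n = ∀ (v : Var) → (v ∈ m) ⇔ (v ∈ n)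

data Concept : Set where
  atom : ConceptName → Concept
  ∃∙   : RoleName → Concept → Concept
  _⊓_  : Concept → Concept → Concept
  ⊤    : Concept

data RHS : Set where
  rA  : ConceptName → RHS
  r∃  : RoleName → RHS

data Axiom : Set where
  gci   : Concept → RHS → Axiom
  rinc  : RoleName → RoleName → Axiom
  ran   : RoleName → ConceptName → Axiom
  cass  : ConceptName → IndName → Axiom
  rass  : RoleName → IndName → IndName → Axiom

-- Annotation v ∈ N_V ∪ {1}: nothing stands for 1.
Annotation : Set
Annotation = Maybe Var

annMon : Annotation → Monomial
annMon nothing  = 𝟙
annMon (just v) = v ∷ []

Ontology : Set
Ontology = List (Axiom × Annotation)

record Interp : Set₁ where
  field
    Δ     : Set
    Δm    : Set
    ind   : IndName → Δ
    conc  : ConceptName → Δ → Δm → Set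
    role  : RoleName → Δ → Δ → Δm → Set
    mon   : Monomial → Δm
    mon-≡ : ∀ m n → (mon m ≡ mon n) ⇔ (m ≈ₘ n)

module _ (I : Interp) where
  open Interp I

  ⟦_⟧ : Concept → Δ → Δm → Set
  ⟦ atom A ⟧ d μ = conc A d μ
  ⟦ ∃∙ R C ⟧ d μ = Σ Δ λ e → Σ Monomial λ m → Σ Monomial λ n →
                     role R d e (mon m) × ⟦ C ⟧ e (mon n) × (μ ≡ mon (m ×ₘ n))
  ⟦ C ⊓ D ⟧ d μ = Σ Monomial λ m → Σ Monomial λ n →
                     ⟦ C ⟧ d (mon m) × ⟦ D ⟧ d (mon n) × (μ ≡ mon (m ×ₘ n))
  ⟦ ⊤ ⟧ d μ = μ ≡ mon 𝟙

  ∃ᴵ : RoleName → Δ → Δm → Set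
  ∃ᴵ R d μ = Σ Δ λ e → role R d e μ

  ranᴵ : RoleName → Δ → Δm → Set
  ranᴵ R e μ = Σ Δ λ d → role R d e μ

  ⟦_⟧ʳ : RHS → Δ → Δm → Set
  ⟦ rA A ⟧ʳ = conc A
  ⟦ r∃ R ⟧ʳ = ∃ᴵ R

  SatGCI : (Δ → Δm → Set) → (Δ → Δm → Set) → Monomial → Set
  SatGCI P Q m = ∀ (d : Δ) (n : Monomial) → P d (mon n) → Q d (mon (m ×ₘ n))

  SatRI : RoleName → RoleName → Monomial → Set
  SatRI R S m = ∀ (d e : Δ) (n : Monomial) → role R d e (mon n) → role S d e (mon (m ×ₘ n))

  SatAx : Axiom → Monomial → Set
  SatAx (gci C D)    m = SatGCI ⟦ C ⟧ ⟦ D ⟧ʳ m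
  SatAx (rinc R S)   m = SatRI R S m
  SatAx (ran R A)    m = SatGCI (ranᴵ R) (conc A) m
  SatAx (cass A a)   m = conc A (ind a) (mon m)
  SatAx (rass R a b) m = role R (ind a) (ind b) (mon m)

  Model : Ontology → Set
  Model O = ∀ {α v} → (α , v) ∈ O → SatAx α (annMon v)

_⊨_⊑_∶_ : Ontology → Concept → Concept → Monomial → Set₁
O ⊨ C ⊑ D ∶ m = ∀ (I : Interp) → Model I O → SatGCI I (⟦ I ⟧ C) (⟦ I ⟧ D) m

_⊨ʳ_⊑_∶_ : Ontology → RoleName → RoleName → Monomial → Set₁
O ⊨ʳ R ⊑ S ∶ m = ∀ (I : Interp) → Model I O → SatRI I R S m

-- Each rule is transitivity of annotated inclusion (annotations multiply) composed
-- with monotonicity of ⊓ and ∃R. in their arguments, or of ∃R.D in R. The only work is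
-- rearranging monomials: ≈ₘ is set equality of lists, under which _++_ is a
-- commutative monoid, and mon identifies exactly the ≈ₘ-equal monomials.
module Submission where

open import Defs
open import Algebra.Bundles using (CommutativeMonoid)
open import Data.List.Properties using (++-assoc)
open import Data.List.Relation.Binary.BagAndSetEquality using (_∼[_]_; set; commutativeMonoid)
open import Data.Product using (_×_; _,_)
open import Function.Bundles using (Equivalence)
open import Relation.Binary.PropositionalEquality using (_≡_; sym; subst)

monomials : CommutativeMonoid _ _
monomials = commutativeMonoid set Var

open CommutativeMonoid monomials using (setoid; ∙-congˡ; assoc)
open import Algebra.Properties.CommutativeSemigroup (CommutativeMonoid.commutativeSemigroup monomials)
  using (interchange; xy∙z≈y∙xz; x∙yz≈y∙xz)
open import Relation.Binary.Reasoning.Setoid setoid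

module _ (I : Interp) where
  open Interp I using (Δ; Δm; mon; mon-≡)

  mon-cong : ∀ {m n} → m ∼[ set ] n → mon m ≡ mon n
  mon-cong {m} {n} m∼n = Equivalence.from (mon-≡ m n) (λ v → m∼n {v})

  mon-injective : ∀ {m n} → mon m ≡ mon n → m ∼[ set ] n
  mon-injective {m} {n} eq {v} = Equivalence.to (mon-≡ m n) eq v

  ⊑-trans : ∀ {P Q T : Δ → Δm → Set} {m k} →
            SatGCI I P Q m → SatGCI I Q T k → SatGCI I P T (m ×ₘ k)
  ⊑-trans {T = T} {m} {k} P⊑Q Q⊑T d n p =
    subst (T d) (sym (mon-cong (xy∙z≈y∙xz m k n))) (Q⊑T d (m ×ₘ n) (P⊑Q d n p))

  ⊓-mono : ∀ {C₁ C₂ D₁ D₂ m₁ m₂} →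
           SatGCI I (⟦ I ⟧ C₁) (⟦ I ⟧ D₁) m₁ → SatGCI I (⟦ I ⟧ C₂) (⟦ I ⟧ D₂) m₂ →
           SatGCI I (⟦ I ⟧ (C₁ ⊓ C₂)) (⟦ I ⟧ (D₁ ⊓ D₂)) (m₁ ×ₘ m₂)
  ⊓-mono {m₁ = m₁} {m₂} C₁⊑D₁ C₂⊑D₂ d n (a , b , c₁ , c₂ , n≡ab) =
    m₁ ×ₘ a , m₂ ×ₘ b , C₁⊑D₁ d a c₁ , C₂⊑D₂ d b c₂ , mon-cong (begin
      (m₁ ×ₘ m₂) ×ₘ n        ≈⟨ ∙-congˡ (mon-injective n≡ab) ⟩
      (m₁ ×ₘ m₂) ×ₘ (a ×ₘ b) ≈⟨ interchange m₁ m₂ a b ⟩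
      (m₁ ×ₘ a) ×ₘ (m₂ ×ₘ b) ∎)

  ∃-mono : ∀ {S D' D m₁} → SatGCI I (⟦ I ⟧ D') (⟦ I ⟧ D) m₁ →
           SatGCI I (⟦ I ⟧ (∃∙ S D')) (⟦ I ⟧ (∃∙ S D)) m₁
  ∃-mono {m₁ = m₁} D'⊑D d n (e , a , b , r , c , n≡ab) =
    e , a , m₁ ×ₘ b , r , D'⊑D e b c , mon-cong (begin
      m₁ ×ₘ n        ≈⟨ ∙-congˡ (mon-injective n≡ab) ⟩
      m₁ ×ₘ (a ×ₘ b) ≈⟨ x∙yz≈y∙xz m₁ a b ⟩
      a ×ₘ (m₁ ×ₘ b) ∎)

  ∃-role-mono : ∀ {R S D m₁} → SatRI I R S m₁ →
                SatGCI I (⟦ I ⟧ (∃∙ R D)) (⟦ I ⟧ (∃∙ S D)) m₁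
  ∃-role-mono {m₁ = m₁} R⊑S d n (e , a , b , r , c , n≡ab) =
    e , m₁ ×ₘ a , b , R⊑S d e a r , c , mon-cong (begin
      m₁ ×ₘ n        ≈⟨ ∙-congˡ (mon-injective n≡ab) ⟩
      m₁ ×ₘ (a ×ₘ b) ≈⟨ assoc m₁ a b ⟨
      (m₁ ×ₘ a) ×ₘ b ∎)

-- The concepts are explicit since they cannot be inferred through ⟦ I ⟧ from the
-- unfolded inclusions.
⊨-trans : ∀ {O} C D E {m k} → O ⊨ C ⊑ D ∶ m → O ⊨ D ⊑ E ∶ k → O ⊨ C ⊑ E ∶ (m ×ₘ k)
⊨-trans C D E C⊑D D⊑E I ⊨O =
  ⊑-trans I {P = ⟦ I ⟧ C} {⟦ I ⟧ D} {⟦ I ⟧ E} (C⊑D I ⊨O) (D⊑E I ⊨O)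

lemma2 : (O : Ontology) (C C₁ C₂ D₁ D₂ D D' : Concept) (S R : RoleName) (m m₁ m₂ : Monomial) →
    ((O ⊨ C ⊑ (C₁ ⊓ C₂) ∶ m) → (O ⊨ C₁ ⊑ D₁ ∶ m₁) → (O ⊨ C₂ ⊑ D₂ ∶ m₂) →
      O ⊨ C ⊑ (D₁ ⊓ D₂) ∶ (m ×ₘ m₁ ×ₘ m₂))
    × ((O ⊨ C ⊑ ∃∙ S D' ∶ m) → (O ⊨ D' ⊑ D ∶ m₁) → O ⊨ C ⊑ ∃∙ S D ∶ (m ×ₘ m₁))
    × ((O ⊨ C ⊑ ∃∙ R D ∶ m) → (O ⊨ʳ R ⊑ S ∶ m₁) → O ⊨ C ⊑ ∃∙ S D ∶ (m ×ₘ m₁))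
lemma2 O C C₁ C₂ D₁ D₂ D D' S R m m₁ m₂ = conjunction , filler , roleInclusion
  where
  conjunction : O ⊨ C ⊑ (C₁ ⊓ C₂) ∶ m → O ⊨ C₁ ⊑ D₁ ∶ m₁ → O ⊨ C₂ ⊑ D₂ ∶ m₂ →
                O ⊨ C ⊑ (D₁ ⊓ D₂) ∶ (m ×ₘ m₁ ×ₘ m₂)
  conjunction C⊑C₁C₂ C₁⊑D₁ C₂⊑D₂ =
    subst (O ⊨ C ⊑ (D₁ ⊓ D₂) ∶_) (sym (++-assoc m m₁ m₂))
      (⊨-trans C (C₁ ⊓ C₂) (D₁ ⊓ D₂) C⊑C₁C₂ λ I ⊨O →
        ⊓-mono I {C₁} {C₂} {D₁} {D₂} (C₁⊑D₁ I ⊨O) (C₂⊑D₂ I ⊨O))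

  filler : O ⊨ C ⊑ ∃∙ S D' ∶ m → O ⊨ D' ⊑ D ∶ m₁ → O ⊨ C ⊑ ∃∙ S D ∶ (m ×ₘ m₁)
  filler C⊑∃SD' D'⊑D =
    ⊨-trans C (∃∙ S D') (∃∙ S D) C⊑∃SD' λ I ⊨O → ∃-mono I {S} {D'} {D} (D'⊑D I ⊨O)

  roleInclusion : O ⊨ C ⊑ ∃∙ R D ∶ m → O ⊨ʳ R ⊑ S ∶ m₁ → O ⊨ C ⊑ ∃∙ S D ∶ (m ×ₘ m₁)
  roleInclusion C⊑∃RD R⊑S =
    ⊨-trans C (∃∙ R D) (∃∙ S D) C⊑∃RD λ I ⊨O → ∃-role-mono I {D = D} (R⊑S I ⊨O)
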